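{- Let $n\ge 1$. If $L$ is a list assignment on the complete graph $K_n$ with $|L(v)|=k$ for all $v\in V(K_n)$, then $D(K_n;L)\ge D(K_n;k)=\binom{k}{n}$.
   Context: A $k$-coloring of a graph $G$ is a map $V(G)\to\{1,\dots,k\}$; a coloring is distinguishing if every nontrivial automorphism of $G$ maps some vertex to a vertex of a different color. Two colorings $c,c'$ of $G$ are equivalent if there is an automorphism $\varphi$ of $G$ with $c(v)=c'(\varphi(v))$ for all $v$. $D(G;k)$ denotes the number of equivalence classes of distinguishing $k$-colorings of $G$. For a list assignment $L=\{L(v)\}_{v\in V(G)}$ (a set of colors $L(v)$ for each vertex), an $L$-coloring is a coloring with the color of each $v$ in $L(v)$, and $D(G;L)$ denotes the number of equivalence classes of distinguishing $L$-colorings of $G$. -}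

module Defs where

open import Data.Nat using (ℕ)
open import Data.Fin using (Fin)
open import Data.List using (List)
open import Data.List.Membership.Propositional using (_∈_)
open import Data.Product using (Σ; ∃; ∃-syntax; _×_)
open import Relation.Nullary using (¬_)
open import Relation.Binary.PropositionalEquality using (_≡_; _≢_)
open import Function.Bundles using (_⇔_)
open import Data.Fin.Permutation using (Permutation′; _⟨$⟩ʳ_)

Graph : ℕ → Set₁
Graph n = Fin n → Fin n → Set

K : (n : ℕ) → Graph n
K n u v = u ≢ v

IsAut : ∀ {n} → Graph n → Permutation′ n → Set
IsAut G φ = ∀ u v → G u v ⇔ G (φ ⟨$⟩ʳ u) (φ ⟨$⟩ʳ v)

Nontrivial : ∀ {n} → Permutation′ n → Set
Nontrivial φ = ¬ (∀ v → φ ⟨$⟩ʳ v ≡ v)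

Coloring : ℕ → Set → Set
Coloring n C = Fin n → C

Distinguishing : ∀ {n C} → Graph n → Coloring n C → Set
Distinguishing G c = ∀ φ → IsAut G φ → Nontrivial φ → ∃[ v ] ¬ (c v ≡ c (φ ⟨$⟩ʳ v))

Equivalent : ∀ {n C} → Graph n → Coloring n C → Coloring n C → Set
Equivalent G c c' = ∃[ φ ] (IsAut G φ × (∀ v → c v ≡ c' (φ ⟨$⟩ʳ v)))

-- The colorings satisfying P fall into exactly m equivalence classes:
-- there are m pairwise inequivalent representatives satisfying P, and
-- every coloring satisfying P is equivalent to one of them.
NumClasses : ∀ {n C} → Graph n → (Coloring n C → Set) → ℕ → Set
NumClasses {n} {C} G P m =
  Σ (Fin m → Coloring n C) λ rep →
    (∀ i → P (rep i)) ×
    (∀ i j → Equivalent G (rep i) (rep j) → i ≡ j) ×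
    (∀ c → P c → ∃[ i ] Equivalent G c (rep i))

-- D(G;k) = m : colors {1,…,k} represented by Fin k.
D-k≡ : ∀ {n} → Graph n → (k : ℕ) → ℕ → Set
D-k≡ G k m = NumClasses {C = Fin k} G (Distinguishing G) m

IsLColoring : ∀ {n} → (Fin n → List ℕ) → Coloring n ℕ → Set
IsLColoring L c = ∀ v → c v ∈ L v

D-L≡ : ∀ {n} → Graph n → (Fin n → List ℕ) → ℕ → Set
D-L≡ G L m = NumClasses {C = ℕ} G (λ c → Distinguishing G c × IsLColoring L c) m

module Submission where

-- On the complete graph K_n every permutation of the vertices is an
-- automorphism.  Hence a coloring is distinguishing iff it is injective, and
-- two injective colorings are equivalent iff they have the same image.  The
-- classes of distinguishing L-colorings are therefore the images of injective
-- L-colorings, and the proof counts families of injective colorings with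
-- pairwise distinct images ("families").
--
--  * Lower bound (Pascal recursion): if every L(v) is duplicate-free of length
--    at least k, some family has at least C(k,n) members.  Fix a color m in
--    L(0): families avoiding m contribute C(k-1,n), families coloring vertex 0
--    by m contribute C(k-1,n-1).
--  * Upper bound (the same recursion): a family whose colors come from a list
--    of length at most k has at most C(k,n) members.
--  * Completion: a greedy pass over the finite list of all L-colorings extends
--    any family to a complete system of class representatives.
--
-- Completing the lower-bound family gives D(K_n;L) >= C(k,n); for the list
-- assignment {1,...,k} the upper bound shows that this count is exactly C(k,n).

open import Defs
open import Data.Nat using (ℕ; zero; suc; _≤_; _+_; z≤n; s≤s; s≤s⁻¹)
import Data.Nat as ℕ
open import Data.Nat.Properties
  using (≤-refl; ≤-reflexive; ≤-trans; ≤-antisym; +-mono-≤; +-comm; +-suc; m≤m+n; module ≤-Reasoning)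
open import Data.Nat.Combinatorics using (_C_; nCk+nC[k+1]≡[n+1]C[k+1])
open import Data.Fin using (Fin; zero; suc; punchIn; punchOut)
import Data.Fin as Fin
open import Data.Fin.Properties using (all?; any?; ¬∀⟶∃¬; punchIn-injective; punchInᵢ≢i; punchIn-punchOut)
open import Data.Fin.Permutation using (Permutation′; permutation; transpose; _⟨$⟩ʳ_; _⟨$⟩ˡ_; inverseˡ; inverseʳ)
open import Data.Vec.Functional using () renaming (_∷_ to _∷ᶜ_)
open import Data.List using (List; []; _∷_; length; _++_; filter; map; lookup; foldl; [_]; allFin; cartesianProductWith)
open import Data.List.Properties using (length-++; length-map; length-filter; length-tabulate; filter-all; ++-identityʳ; ++-assoc)
open import Data.List.Relation.Unary.All as All using (All; []; _∷_)
import Data.List.Relation.Unary.All.Properties as AllP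
open import Data.List.Relation.Unary.Any as Any using (Any; here; there)
import Data.List.Relation.Unary.Any.Properties as AnyP
open import Data.List.Relation.Unary.AllPairs using (AllPairs; []; _∷_)
import Data.List.Relation.Unary.AllPairs.Properties as AllPairsP
open import Data.List.Relation.Unary.Unique.Propositional using (Unique)
import Data.List.Relation.Unary.Unique.Propositional.Properties as UniqueP
open import Data.List.Membership.Propositional using (_∈_)
open import Data.List.Membership.Propositional.Properties
  using (∈-filter⁻; ∈-filter⁺; ∈-cartesianProductWith⁺; ∈-allFin; ∈-lookup)
open import Data.Product using (∃-syntax; _×_; _,_; proj₁; proj₂)
open import Data.Empty using (⊥-elim)
open import Relation.Nullary using (¬_; Dec; yes; no; ¬?)
open import Relation.Nullary.Decidable using (_×-dec_; _→-dec_)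
open import Relation.Unary using (Decidable)
open import Relation.Binary.Definitions using (DecidableEquality)
open import Relation.Binary.PropositionalEquality using (_≡_; _≢_; _≗_; refl; sym; trans; cong; subst)
open import Function.Bundles using (mk⇔)

length-filter-split : ∀ {A : Set} {P : A → Set} (P? : Decidable P) (xs : List A) →
  length xs ≡ length (filter P? xs) + length (filter (λ x → ¬? (P? x)) xs)
length-filter-split P? [] = refl
length-filter-split P? (x ∷ xs) with P? x
... | yes _ = cong suc (length-filter-split P? xs)
... | no _  = trans (cong suc (length-filter-split P? xs)) (sym (+-suc _ _))

AllPairs-weaken : ∀ {A : Set} {P : A → Set} {R S : A → A → Set} {xs : List A} →
  (∀ {x y} → P x → P y → R x y → S x y) → All P xs → AllPairs R xs → AllPairs S xs
AllPairs-weaken h [] [] = []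
AllPairs-weaken {P = P} {R} {S} h (px ∷ pxs) (rx ∷ rxs) = heads pxs rx ∷ AllPairs-weaken h pxs rxs
  where
  heads : ∀ {ys} → All P ys → All (R _) ys → All (S _) ys
  heads [] [] = []
  heads (py ∷ pys) (r ∷ rs) = h px py r ∷ heads pys rs

AllPairs-lookup : ∀ {A : Set} {R : A → A → Set} → (∀ {x y} → R x y → R y x) →
  ∀ {xs} → AllPairs (λ x y → ¬ R x y) xs → ∀ i j → R (lookup xs i) (lookup xs j) → i ≡ j
AllPairs-lookup sym-R (_ ∷ _) zero zero r = refl
AllPairs-lookup sym-R (unrelated ∷ _) zero (suc j) r = ⊥-elim (All.lookup unrelated (∈-lookup j) r)
AllPairs-lookup sym-R (unrelated ∷ _) (suc i) zero r = ⊥-elim (All.lookup unrelated (∈-lookup i) (sym-R r))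
AllPairs-lookup sym-R (_ ∷ pairs) (suc i) (suc j) r = cong suc (AllPairs-lookup sym-R pairs i j r)

nonempty-member : ∀ {A : Set} {k} (xs : List A) → suc k ≤ length xs → ∃[ m ] m ∈ xs
nonempty-member (x ∷ _) _ = x , here refl

module Completion {A : Set} {P : A → Set} {_∼_ : A → A → Set}
  (P? : Decidable P) (_∼?_ : ∀ x y → Dec (x ∼ y))
  (∼-refl : ∀ {x} → x ∼ x) (∼-sym : ∀ {x y} → x ∼ y → y ∼ x) where

  Valid : List A → Set
  Valid xs = All P xs × AllPairs (λ x y → ¬ x ∼ y) xs

  insert : List A → A → List A
  insert acc x with P? x | Any.any? (x ∼?_) acc
  ... | yes _ | no _ = acc ++ [ x ]
  ... | _     | _    = acc

  complete : List A → List A → List A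
  complete = foldl insert

  insert-valid : ∀ acc x → Valid acc → Valid (insert acc x)
  insert-valid acc x (ps , pairs) with P? x | Any.any? (x ∼?_) acc
  ... | yes px | no unrelated =
    AllP.++⁺ ps (px ∷ []) ,
    AllPairsP.++⁺ pairs ([] ∷ []) (All.map (λ x≁a → (λ a∼x → x≁a (∼-sym a∼x)) ∷ []) (AllP.¬Any⇒All¬ acc unrelated))
  ... | yes _ | yes _ = ps , pairs
  ... | no _  | _     = ps , pairs

  insert-extends : ∀ acc x → ∃[ ys ] insert acc x ≡ acc ++ ys
  insert-extends acc x with P? x | Any.any? (x ∼?_) acc
  ... | yes _ | no _  = [ x ] , refl
  ... | yes _ | yes _ = [] , sym (++-identityʳ acc)
  ... | no _  | _     = [] , sym (++-identityʳ acc)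

  insert-covers : ∀ acc {x} → P x → Any (x ∼_) (insert acc x)
  insert-covers acc {x} px with P? x | Any.any? (x ∼?_) acc
  ... | yes _  | no _    = AnyP.++⁺ʳ acc (here ∼-refl)
  ... | yes _  | yes rel = rel
  ... | no ¬px | _       = ⊥-elim (¬px px)

  complete-valid : ∀ acc xs → Valid acc → Valid (complete acc xs)
  complete-valid acc [] v = v
  complete-valid acc (x ∷ xs) v = complete-valid (insert acc x) xs (insert-valid acc x v)

  complete-extends : ∀ acc xs → ∃[ ys ] complete acc xs ≡ acc ++ ys
  complete-extends acc [] = [] , sym (++-identityʳ acc)
  complete-extends acc (x ∷ xs) with insert-extends acc x | complete-extends (insert acc x) xs
  ... | ys , inserted | zs , completed =
    ys ++ zs , trans completed (trans (cong (_++ zs) inserted) (++-assoc acc ys zs))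

  complete-length : ∀ acc xs → length acc ≤ length (complete acc xs)
  complete-length acc xs with complete-extends acc xs
  ... | ys , eq = ≤-trans (m≤m+n (length acc) (length ys)) (≤-reflexive (sym (trans (cong length eq) (length-++ acc))))

  complete-covers : ∀ acc {xs x} → x ∈ xs → P x → Any (x ∼_) (complete acc xs)
  complete-covers acc {x ∷ xs} (here refl) px with complete-extends (insert acc x) xs
  ... | ys , eq = subst (Any (x ∼_)) (sym eq) (AnyP.++⁺ˡ (insert-covers acc px))
  complete-covers acc {y ∷ xs} (there x∈xs) px = complete-covers (insert acc y) x∈xs px

permutation-isAut : ∀ {n} (π : Permutation′ n) → IsAut (K n) π
permutation-isAut π u v = mk⇔ (λ u≢v πu≡πv → u≢v (injective πu≡πv)) (λ πu≢πv u≡v → πu≢πv (cong (π ⟨$⟩ʳ_) u≡v))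
  where
  injective : ∀ {u v} → π ⟨$⟩ʳ u ≡ π ⟨$⟩ʳ v → u ≡ v
  injective eq = trans (sym (inverseˡ π)) (trans (cong (π ⟨$⟩ˡ_) eq) (inverseˡ π))

Injective : ∀ {n Col} → Coloring n Col → Set
Injective c = ∀ u v → c u ≡ c v → u ≡ v

transpose-respects : ∀ {n Col} (c : Coloring n Col) {u v} → c u ≡ c v → ∀ w → c w ≡ c (transpose u v ⟨$⟩ʳ w)
transpose-respects c {u} {v} cu≡cv w with w Fin.≟ u
... | yes refl = cu≡cv
... | no _ with w Fin.≟ v
...   | yes refl = sym cu≡cv
...   | no _     = refl

transpose-moves : ∀ {n} (u v : Fin n) → transpose u v ⟨$⟩ʳ u ≡ v
transpose-moves u v with u Fin.≟ u
... | yes _ = refl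
... | no u≢u = ⊥-elim (u≢u refl)

-- A nontrivial permutation moves some vertex, which an injective coloring detects.
injective⇒distinguishing : ∀ {n Col} (c : Coloring n Col) → Injective c → Distinguishing (K n) c
injective⇒distinguishing {n} c inj φ _ nontrivial
  with ¬∀⟶∃¬ n (λ v → φ ⟨$⟩ʳ v ≡ v) (λ v → φ ⟨$⟩ʳ v Fin.≟ v) nontrivial
... | v , moved = v , λ same → moved (sym (inj _ _ same))

-- Two distinct vertices of the same color are swapped by an automorphism fixing the coloring.
distinguishing⇒injective : ∀ {n Col} (c : Coloring n Col) → Distinguishing (K n) c → Injective c
distinguishing⇒injective c dist u v cu≡cv with u Fin.≟ v
... | yes u≡v = u≡v
... | no u≢v with dist (transpose u v) (permutation-isAut (transpose u v))
                        (λ fixes → u≢v (trans (sym (fixes u)) (transpose-moves u v)))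
...   | w , differs = ⊥-elim (differs (transpose-respects c cu≡cv w))

_⊑_ : ∀ {n Col} → Coloring n Col → Coloring n Col → Set
c ⊑ c' = ∀ v → ∃[ w ] c v ≡ c' w

SameImage : ∀ {n Col} → Coloring n Col → Coloring n Col → Set
SameImage c c' = c ⊑ c' × c' ⊑ c

-- Distinct images: on injective colorings, inequivalence.
Distinct : ∀ {n Col} → Coloring n Col → Coloring n Col → Set
Distinct c c' = ¬ SameImage c c'

sameImage-refl : ∀ {n Col} {c : Coloring n Col} → SameImage c c
sameImage-refl = (λ v → v , refl) , (λ v → v , refl)

sameImage-sym : ∀ {n Col} {c c' : Coloring n Col} → SameImage c c' → SameImage c' c
sameImage-sym (c⊑c' , c'⊑c) = c'⊑c , c⊑c'

sameImage-resp-≗ : ∀ {n Col} {c f r : Coloring n Col} → c ≗ f → SameImage f r → SameImage c r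
sameImage-resp-≗ c≗f (f⊑r , r⊑f) =
  (λ v → proj₁ (f⊑r v) , trans (c≗f v) (proj₂ (f⊑r v))) ,
  (λ w → proj₁ (r⊑f w) , trans (proj₂ (r⊑f w)) (sym (c≗f _)))

equivalent⇒sameImage : ∀ {n Col} {c c' : Coloring n Col} → Equivalent (K n) c c' → SameImage c c'
equivalent⇒sameImage {c' = c'} (π , _ , c≡c'∘π) =
  (λ v → π ⟨$⟩ʳ v , c≡c'∘π v) ,
  (λ w → π ⟨$⟩ˡ w , trans (cong c' (sym (inverseʳ π))) (sym (c≡c'∘π (π ⟨$⟩ˡ w))))

-- For injective colorings the two inclusions of images are mutually inverse bijections.
sameImage⇒equivalent : ∀ {n Col} {c c' : Coloring n Col} → Injective c → Injective c' →
  SameImage c c' → Equivalent (K n) c c'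
sameImage⇒equivalent {c = c} {c'} inj inj' (c⊑c' , c'⊑c) = π , permutation-isAut π , λ v → proj₂ (c⊑c' v)
  where
  π : Permutation′ _
  π = permutation (λ v → proj₁ (c⊑c' v)) (λ w → proj₁ (c'⊑c w))
    (λ w → inj' _ _ (trans (sym (proj₂ (c⊑c' _))) (sym (proj₂ (c'⊑c w)))))
    (λ v → inj _ _ (trans (sym (proj₂ (c'⊑c _))) (sym (proj₂ (c⊑c' v)))))

Uses : ∀ {n Col} → Col → Coloring n Col → Set
Uses m c = ∃[ v ] c v ≡ m

distinct-uses : ∀ {n Col} {m : Col} {a c : Coloring n Col} → ¬ Uses m a → Uses m c → Distinct a c
distinct-uses a-avoids (v , cv≡m) (_ , c⊑a) with c⊑a v
... | w , cv≡aw = a-avoids (w , trans (sym cv≡aw) cv≡m)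

⊑-prefix : ∀ {n Col} {m : Col} {c c' : Coloring n Col} → ¬ Uses m c → (m ∷ᶜ c) ⊑ (m ∷ᶜ c') → c ⊑ c'
⊑-prefix avoids prefixed v with prefixed (suc v)
... | zero , cv≡m = ⊥-elim (avoids (v , cv≡m))
... | suc w , cv≡c'w = w , cv≡c'w

⊑-punchIn : ∀ {n Col} {m : Col} {c c' : Coloring (suc n) Col} {v₀ v₀'} → c v₀ ≡ m → c' v₀' ≡ m →
  (λ u → c (punchIn v₀ u)) ⊑ (λ u → c' (punchIn v₀' u)) → c ⊑ c'
⊑-punchIn {c = c} {c'} {v₀} {v₀'} cv₀≡m c'v₀'≡m punched v with v₀ Fin.≟ v
... | yes refl = v₀' , trans cv₀≡m (sym c'v₀'≡m)
... | no v₀≢v with punched (punchOut v₀≢v)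
...   | w , same = punchIn v₀' w , trans (cong c (sym (punchIn-punchOut v₀≢v))) same

-- The colorings counted by D(K_n;L): injective L-colorings.
Good : ∀ {n Col} → (Fin n → List Col) → Coloring n Col → Set
Good L c = Injective c × (∀ v → c v ∈ L v)

-- A family: injective L-colorings with pairwise distinct images, i.e.
-- pairwise inequivalent distinguishing L-colorings.
Family : ∀ {n Col} → (Fin n → List Col) → List (Coloring n Col) → Set
Family L R = All (Good L) R × AllPairs Distinct R

filter-family : ∀ {n Col} {L : Fin n → List Col} {P : Coloring n Col → Set} (P? : Decidable P) {R} →
  Family L R → Family L (filter P? R)
filter-family P? (good , distinct) = AllP.filter⁺ P? good , AllPairsP.filter⁺ P? distinct

family⇒numClasses : ∀ {n Col} {L : Fin n → List Col} {R} (P : Coloring n Col → Set) →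
  (∀ c → P c → Good L c) → (∀ c → Good L c → P c) →
  Family L R → (∀ c → Good L c → Any (SameImage c) R) → NumClasses (K n) P (length R)
family⇒numClasses {R = R} P P⇒good good⇒P (good , distinct) meets =
  lookup R , (λ i → good⇒P _ (goodAt i)) ,
  (λ i j equiv → AllPairs-lookup sameImage-sym distinct i j (equivalent⇒sameImage equiv)) ,
  represented
  where
  goodAt : ∀ i → Good _ (lookup R i)
  goodAt i = All.lookup good (∈-lookup i)
  represented : ∀ c → P c → ∃[ i ] Equivalent (K _) c (lookup R i)
  represented c pc =
    let hit = meets c (P⇒good c pc) in
    Any.index hit ,
    sameImage⇒equivalent (proj₁ (P⇒good c pc)) (proj₁ (goodAt (Any.index hit))) (AnyP.lookup-index hit)

module Counting {Col : Set} (_≟_ : DecidableEquality Col) where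

  open import Data.List.Membership.DecPropositional _≟_ using (_∈?_)

  good? : ∀ {n} (L : Fin n → List Col) → Decidable (Good L)
  good? L c = (all? λ u → all? λ v → (c u ≟ c v) →-dec (u Fin.≟ v)) ×-dec all? (λ v → c v ∈? L v)

  sameImage? : ∀ {n} (c c' : Coloring n Col) → Dec (SameImage c c')
  sameImage? c c' = (all? λ v → any? λ w → c v ≟ c' w) ×-dec (all? λ w → any? λ v → c' w ≟ c v)

  -- All L-colorings, listed up to pointwise equality.
  allColorings : ∀ n → (Fin n → List Col) → List (Coloring n Col)
  allColorings zero L = [ (λ ()) ]
  allColorings (suc n) L = cartesianProductWith _∷ᶜ_ (L zero) (allColorings n (λ v → L (suc v)))

  allColorings-complete : ∀ n (L : Fin n → List Col) (c : Coloring n Col) → (∀ v → c v ∈ L v) →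
    ∃[ f ] (f ∈ allColorings n L × c ≗ f)
  allColorings-complete zero L c _ = (λ ()) , here refl , λ ()
  allColorings-complete (suc n) L c c∈L
    with allColorings-complete n (λ v → L (suc v)) (λ v → c (suc v)) (λ v → c∈L (suc v))
  ... | f , f∈ , tail≗f = c zero ∷ᶜ f , ∈-cartesianProductWith⁺ _∷ᶜ_ (c∈L zero) f∈ , c≗
    where
    c≗ : c ≗ (c zero ∷ᶜ f)
    c≗ zero = refl
    c≗ (suc v) = tail≗f v

  completeFamily : ∀ {n} (L : Fin n → List Col) {R₀} → Family L R₀ →
    ∃[ R ] (Family L R × length R₀ ≤ length R × (∀ c → Good L c → Any (SameImage c) R))
  completeFamily {n} L {R₀} family₀ =
    complete R₀ candidates , complete-valid R₀ candidates family₀ , complete-length R₀ candidates , meets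
    where
    open Completion (good? L) sameImage? sameImage-refl sameImage-sym
    candidates = allColorings n L
    meets : ∀ c → Good L c → Any (SameImage c) (complete R₀ candidates)
    meets c (inj , c∈L) with allColorings-complete n L c c∈L
    ... | f , f∈ , c≗f =
      Any.map (sameImage-resp-≗ c≗f) (complete-covers R₀ f∈ (inj' , λ v → subst (_∈ L v) (c≗f v) (c∈L v)))
      where
      inj' : Injective f
      inj' u v fu≡fv = inj u v (trans (c≗f u) (trans fu≡fv (sym (c≗f v))))

  remove : Col → List Col → List Col
  remove m = filter (λ x → ¬? (x ≟ m))

  ∈-remove⁺ : ∀ {m x} xs → x ∈ xs → x ≢ m → x ∈ remove m xs
  ∈-remove⁺ {m} xs = ∈-filter⁺ (λ x → ¬? (x ≟ m)) {xs = xs}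

  ∈-remove⁻ : ∀ {m x} xs → x ∈ remove m xs → x ∈ xs × x ≢ m
  ∈-remove⁻ {m} xs = ∈-filter⁻ (λ x → ¬? (x ≟ m)) {xs = xs}

  length-remove-unique : ∀ m xs → Unique xs → length xs ≤ suc (length (remove m xs))
  length-remove-unique m [] _ = z≤n
  length-remove-unique m (x ∷ xs) (x∉xs ∷ unique) with x ≟ m
  ... | yes refl = s≤s (≤-reflexive (sym (cong length (filter-all (λ y → ¬? (y ≟ x)) (All.map (λ x≢y y≡x → x≢y (sym y≡x)) x∉xs)))))
  ... | no _ = s≤s (length-remove-unique m xs unique)

  Admissible : ∀ {n} → ℕ → (Fin n → List Col) → Set
  Admissible k L = ∀ v → Unique (L v) × k ≤ length (L v)

  remove-admissible : ∀ {n k} {L : Fin n → List Col} m → Admissible (suc k) L → Admissible k (λ v → remove m (L v))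
  remove-admissible {L = L} m adm v =
    UniqueP.filter⁺ (λ x → ¬? (x ≟ m)) (proj₁ (adm v)) ,
    s≤s⁻¹ (≤-trans (proj₂ (adm v)) (length-remove-unique m (L v) (proj₁ (adm v))))

  uses? : ∀ {n} (m : Col) → Decidable (Uses {n} m)
  uses? m c = any? (λ v → c v ≟ m)

  avoids-removed : ∀ {n m} {L : Fin n → List Col} {c} → Good (λ v → remove m (L v)) c → ¬ Uses m c
  avoids-removed {L = L} (_ , c∈) (v , cv≡m) = proj₂ (∈-remove⁻ (L v) (c∈ v)) cv≡m

  good-removed : ∀ {n m} {L : Fin n → List Col} {c} → Good (λ v → remove m (L v)) c → Good L c
  good-removed {L = L} (inj , c∈) = inj , λ v → proj₁ (∈-remove⁻ (L v) (c∈ v))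

  good-prefix : ∀ {n m} {L : Fin (suc n) → List Col} {c} → m ∈ L zero →
    Good (λ v → remove m (L (suc v))) c → Good L (m ∷ᶜ c)
  good-prefix {L = L} {c} m∈ good@(inj , c∈) = inj' , c∈'
    where
    avoids = avoids-removed {L = λ v → L (suc v)} good
    inj' : Injective (_ ∷ᶜ c)
    inj' zero zero _ = refl
    inj' zero (suc v) m≡cv = ⊥-elim (avoids (v , sym m≡cv))
    inj' (suc u) zero cu≡m = ⊥-elim (avoids (u , cu≡m))
    inj' (suc u) (suc v) cu≡cv = cong suc (inj u v cu≡cv)
    c∈' : ∀ v → (_ ∷ᶜ c) v ∈ L v
    c∈' zero = m∈
    c∈' (suc v) = proj₁ (∈-remove⁻ (L (suc v)) (c∈ v))

  prefix-family : ∀ {n m} {L : Fin (suc n) → List Col} {R} → m ∈ L zero →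
    Family (λ v → remove m (L (suc v))) R → Family L (map (m ∷ᶜ_) R)
  prefix-family {L = L} m∈ (good , distinct) =
    AllP.map⁺ (All.map (good-prefix m∈) good) ,
    AllPairsP.map⁺ (AllPairs-weaken prefixed-distinct good distinct)
    where
    avoids = avoids-removed {L = λ v → L (suc v)}
    prefixed-distinct : ∀ {c c'} → Good _ c → Good _ c' → Distinct c c' → Distinct (_ ∷ᶜ c) (_ ∷ᶜ c')
    prefixed-distinct gc gc' c≠c' (c⊑c' , c'⊑c) = c≠c' (⊑-prefix (avoids gc) c⊑c' , ⊑-prefix (avoids gc') c'⊑c)

  join-families : ∀ {n m} {L : Fin (suc n) → List Col} {R₁ R₂} → m ∈ L zero →
    Family (λ v → remove m (L v)) R₁ → Family (λ v → remove m (L (suc v))) R₂ →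
    Family L (R₁ ++ map (m ∷ᶜ_) R₂)
  join-families {m = m} {L} {R₁} {R₂} m∈ family₁@(good₁ , distinct₁) family₂ =
    AllP.++⁺ (All.map good-removed good₁) (proj₁ family₂') ,
    AllPairsP.++⁺ distinct₁ (proj₂ family₂') (All.map across good₁)
    where
    family₂' = prefix-family m∈ family₂
    across : ∀ {a} → Good (λ v → remove m (L v)) a → All (Distinct a) (map (m ∷ᶜ_) R₂)
    across ga = AllP.map⁺ (All.universal (λ c → distinct-uses (avoids-removed {L = L} ga) (zero , refl)) R₂)

  largeFamily : ∀ k n (L : Fin n → List Col) → Admissible k L → ∃[ R ] (Family L R × k C n ≤ length R)
  largeFamily k zero L _ = [ (λ ()) ] , (((λ ()) , (λ ())) ∷ [] , [] ∷ []) , ≤-refl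
  largeFamily zero (suc n) L _ = [] , ([] , []) , z≤n
  largeFamily (suc k) (suc n) L adm with nonempty-member (L zero) (proj₂ (adm zero))
  ... | m , m∈ with largeFamily k (suc n) _ (remove-admissible m adm)
                  | largeFamily k n _ (λ v → remove-admissible m adm (suc v))
  ...   | R₁ , family₁ , bound₁ | R₂ , family₂ , bound₂ =
    R₁ ++ map (m ∷ᶜ_) R₂ , join-families m∈ family₁ family₂ , count
    where
    open ≤-Reasoning
    count : suc k C suc n ≤ length (R₁ ++ map (m ∷ᶜ_) R₂)
    count = begin
      suc k C suc n           ≡⟨ sym (nCk+nC[k+1]≡[n+1]C[k+1] k n) ⟩
      k C n + k C suc n       ≡⟨ +-comm (k C n) (k C suc n) ⟩
      k C suc n + k C n       ≤⟨ +-mono-≤ bound₁ (≤-trans bound₂ (≤-reflexive (sym (length-map (m ∷ᶜ_) R₂)))) ⟩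
      length R₁ + length (map (m ∷ᶜ_) R₂) ≡⟨ sym (length-++ R₁) ⟩
      length (R₁ ++ map (m ∷ᶜ_) R₂) ∎

  avoid-family : ∀ {n m U} {R : List (Coloring n Col)} → Family (λ _ → m ∷ U) R → All (λ c → ¬ Uses m c) R →
    Family (λ _ → remove m U) R
  avoid-family {m = m} {U} (good , distinct) avoiding = All.zipWith restrict (good , avoiding) , distinct
    where
    restrict : ∀ {c} → Good (λ _ → m ∷ U) c × ¬ Uses m c → Good (λ _ → remove m U) c
    restrict ((inj , c∈) , avoids) = inj , λ v → from (c∈ v) (λ cv≡m → avoids (v , cv≡m))
      where
      from : ∀ {x} → x ∈ m ∷ U → x ≢ m → x ∈ remove m U
      from (here x≡m) x≢m = ⊥-elim (x≢m x≡m)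
      from (there x∈U) x≢m = ∈-remove⁺ U x∈U x≢m

  -- Delete a vertex colored m (vertex 0 if there is none).
  dropColor : ∀ {n} → Col → Coloring (suc n) Col → Coloring n Col
  dropColor m c with uses? m c
  ... | yes (v₀ , _) = λ u → c (punchIn v₀ u)
  ... | no _ = λ u → c (suc u)

  dropColor-spec : ∀ {n m} (c : Coloring (suc n) Col) → Uses m c →
    ∃[ v₀ ] (c v₀ ≡ m × dropColor m c ≡ (λ u → c (punchIn v₀ u)))
  dropColor-spec {m = m} c uses with uses? m c
  ... | yes (v₀ , cv₀≡m) = v₀ , cv₀≡m , refl
  ... | no unused = ⊥-elim (unused uses)

  good-dropColor : ∀ {n m U} {c : Coloring (suc n) Col} → Good (λ _ → m ∷ U) c → Uses m c →
    Good (λ _ → remove m U) (dropColor m c)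
  good-dropColor {m = m} {U} {c} (inj , c∈) uses with dropColor-spec c uses
  ... | v₀ , cv₀≡m , eq rewrite eq = (λ u w same → punchIn-injective v₀ u w (inj _ _ same)) , c∈'
    where
    c∈' : ∀ u → c (punchIn v₀ u) ∈ remove m U
    c∈' u with c∈ (punchIn v₀ u)
    ... | here cu≡m = ⊥-elim (punchInᵢ≢i v₀ u (inj _ _ (trans cu≡m (sym cv₀≡m))))
    ... | there cu∈U = ∈-remove⁺ U cu∈U (λ cu≡m → punchInᵢ≢i v₀ u (inj _ _ (trans cu≡m (sym cv₀≡m))))

  distinct-dropColor : ∀ {n m} {c c' : Coloring (suc n) Col} → Uses m c → Uses m c' →
    Distinct c c' → Distinct (dropColor m c) (dropColor m c')
  distinct-dropColor {c = c} {c'} uses uses' c≠c' with dropColor-spec c uses | dropColor-spec c' uses'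
  ... | v₀ , cv₀≡m , eq | v₀' , c'v₀'≡m , eq' rewrite eq | eq' =
    λ (d⊑d' , d'⊑d) → c≠c' (⊑-punchIn cv₀≡m c'v₀'≡m d⊑d' , ⊑-punchIn c'v₀'≡m cv₀≡m d'⊑d)

  dropColor-family : ∀ {n m U} {R : List (Coloring (suc n) Col)} → Family (λ _ → m ∷ U) R → All (Uses m) R →
    Family (λ _ → remove m U) (map (dropColor m) R)
  dropColor-family (good , distinct) allUse =
    AllP.map⁺ (All.zipWith (λ (gc , uc) → good-dropColor gc uc) (good , allUse)) ,
    AllPairsP.map⁺ (AllPairs-weaken distinct-dropColor allUse distinct)

  smallFamily : ∀ k n (U : List Col) → length U ≤ k → (R : List (Coloring n Col)) → Family (λ _ → U) R →
    length R ≤ k C n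
  smallFamily k zero U _ [] _ = z≤n
  smallFamily k zero U _ (_ ∷ []) _ = ≤-refl
  smallFamily k zero U _ (_ ∷ _ ∷ _) (_ , ((c≠c' ∷ _) ∷ _)) = ⊥-elim (c≠c' ((λ ()) , (λ ())))
  smallFamily k (suc n) U _ [] _ = z≤n
  smallFamily k (suc n) [] _ (c ∷ _) ((_ , c∈) ∷ _ , _) with c∈ zero
  ... | ()
  smallFamily zero (suc n) (m ∷ U) () _ _
  smallFamily (suc k) (suc n) (m ∷ U) |U|≤ R family = begin
    length R                          ≡⟨ length-filter-split (uses? m) R ⟩
    length users + length avoiders    ≤⟨ +-mono-≤ bound-users bound-avoiders ⟩
    k C n + k C suc n                 ≡⟨ nCk+nC[k+1]≡[n+1]C[k+1] k n ⟩
    suc k C suc n                     ∎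
    where
    open ≤-Reasoning
    users = filter (uses? m) R
    avoiders = filter (λ c → ¬? (uses? m c)) R
    |U'|≤ : length (remove m U) ≤ k
    |U'|≤ = ≤-trans (length-filter (λ x → ¬? (x ≟ m)) U) (s≤s⁻¹ |U|≤)
    bound-avoiders : length avoiders ≤ k C suc n
    bound-avoiders = smallFamily k (suc n) (remove m U) |U'|≤ avoiders
      (avoid-family (filter-family (λ c → ¬? (uses? m c)) family) (AllP.all-filter (λ c → ¬? (uses? m c)) R))
    bound-users : length users ≤ k C n
    bound-users = subst (_≤ k C n) (length-map (dropColor m) users)
      (smallFamily k n (remove m U) |U'|≤ (map (dropColor m) users)
        (dropColor-family (filter-family (uses? m) family) (AllP.all-filter (uses? m) R)))

  representatives : ∀ {n} k (L : Fin n → List Col) → Admissible k L → (P : Coloring n Col → Set) →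
    (∀ c → P c → Good L c) → (∀ c → Good L c → P c) →
    ∃[ R ] (Family L R × NumClasses (K n) P (length R) × k C n ≤ length R)
  representatives {n} k L adm P P⇒good good⇒P with largeFamily k n L adm
  ... | R₀ , family₀ , bound₀ with completeFamily L family₀
  ...   | R , family , longer , meets =
    R , family , family⇒numClasses P P⇒good good⇒P family meets , ≤-trans bound₀ longer

listClasses : ∀ {n} k (L : Fin n → List ℕ) → (∀ v → Unique (L v)) → (∀ v → length (L v) ≡ k) →
  ∃[ d ] (D-L≡ (K n) L d × k C n ≤ d)
listClasses {n} k L unique length≡k
  with Counting.representatives ℕ._≟_ k L (λ v → unique v , ≤-reflexive (sym (length≡k v)))
         (λ c → Distinguishing (K n) c × IsLColoring L c)
         (λ c (dist , c∈L) → distinguishing⇒injective c dist , c∈L)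
         (λ c (inj , c∈L) → injective⇒distinguishing c inj , c∈L)
... | R , _ , classes , lower = length R , classes , lower

-- D(K_n;k) = C(k,n): with the palette {1,...,k} the upper bound makes the count exact.
paletteClasses : ∀ n k → D-k≡ (K n) k (k C n)
paletteClasses n k
  with Counting.representatives (Fin._≟_ {k}) k (λ (_ : Fin n) → allFin k)
         (λ _ → UniqueP.allFin⁺ k , ≤-reflexive (sym (length-tabulate (λ i → i))))
         (Distinguishing (K n))
         (λ c dist → distinguishing⇒injective c dist , λ v → ∈-allFin (c v))
         (λ c (inj , _) → injective⇒distinguishing c inj)
... | R , family , classes , lower = subst (D-k≡ (K n) k) exact classes
  where
  exact : length R ≡ k C n
  exact = ≤-antisym (Counting.smallFamily (Fin._≟_ {k}) k n (allFin k) (≤-reflexive (length-tabulate (λ i → i))) R family) lower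

-- Lemma 5.
lemma5 : (n : ℕ) → 1 ≤ n → (k : ℕ) → (L : Fin n → List ℕ) →
    (∀ v → Unique (L v)) → (∀ v → length (L v) ≡ k) →
    D-k≡ (K n) k (k C n) ×
    (∃[ d ] (D-L≡ (K n) L d × k C n ≤ d))
lemma5 n _ k L unique length≡k = paletteClasses n k , listClasses k L unique length≡k
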